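{- Let $k$ and $h$ be positive integers. There exists a regular commutative graph of ratio $1$ of level $h$, with layers $U_0,\dots,U_h$, such that for every $v\in U_0$ there exist pairwise distinct vertices $\{y^j_x : x\in\operatorname{im}(v),\ 1\le j\le k\}\subseteq U_0$ with $y^j_x x$ an edge of the graph for all $x\in\operatorname{im}(v)$ and $1\le j\le k$ (a one-to-$k$ matching from $\operatorname{im}(v)$ to $U_0$).
   Context: A directed layered graph of level $h$ has vertex set $U_0\cup\dots\cup U_h$, a disjoint union of finite sets, with every directed edge going from some $U_i$ to $U_{i+1}$. For a vertex $x$, $\operatorname{im}(x)$, $\operatorname{im}^{ -1}(x)$ denote its out- and in-neighbourhoods. The graph is commutative if: (upward) for every edge $uv$ there is an injective $\varphi:\operatorname{im}(v)\to\operatorname{im}(u)$ with $\varphi(x)x$ an edge for all $x$; and (downward) for every edge $vw$ there is an injective $\psi:\operatorname{im}^{ -1}(v)\to\operatorname{im}^{ -1}(w)$ with $x\psi(x)$ an edge for all $x$. A commutative graph is regular of ratio $C$ if there is a positive integer $d$ such that every vertex not in the bottom layer has in-degree $d$ and every vertex not in the top layer has out-degree $Cd$. -}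

module Defs where

open import Data.Nat using (ℕ; zero; suc; _+_; _<_; _≤_)
open import Data.Fin using (Fin)
open import Data.Bool using (Bool; true; false)
open import Data.Product using (Σ; _×_; ∃)
open import Relation.Binary.PropositionalEquality using (_≡_)

count : ∀ {m} → (Fin m → Bool) → ℕ
count {zero}  f = 0
count {suc m} f with f Fin.zero
... | true  = suc (count (λ x → f (Fin.suc x)))
... | false = count (λ x → f (Fin.suc x))

-- A (finite) directed layered graph: layer U_i is Fin (size i), and the
-- edges from U_i to U_{i+1} are given by the Boolean matrix  edge i.
-- Only layers 0..h and edge-sets i < h are relevant for a graph of level h.
record LayeredGraph : Set where
  field
    size : ℕ → ℕ
    edge : (i : ℕ) → Fin (size i) → Fin (size (suc i)) → Bool

module _ (G : LayeredGraph) where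
  open LayeredGraph G

  E : (i : ℕ) → Fin (size i) → Fin (size (suc i)) → Set
  E i u x = edge i u x ≡ true

  outdeg : (i : ℕ) → Fin (size i) → ℕ
  outdeg i u = count (λ x → edge i u x)

  indeg : (i : ℕ) → Fin (size (suc i)) → ℕ
  indeg i x = count (λ u → edge i u x)

  -- upward condition: for every edge u v (u ∈ U_i, v ∈ U_{i+1}, i+1 < h) there is
  -- an injective φ : im(v) → im(u) with φ(x) x an edge.
  -- (If i + 1 = h then im(v) = ∅ and the condition is vacuous.)
  Upward : ℕ → Set
  Upward h = ∀ i → suc i < h → ∀ u v → E i u v →
    Σ ((x : Fin (size (suc (suc i)))) → E (suc i) v x → Fin (size (suc i))) λ φ →
      (∀ x p → E i u (φ x p) × E (suc i) (φ x p) x) ×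
      (∀ x p x' p' → φ x p ≡ φ x' p' → x ≡ x')

  -- downward condition: for every edge v w (v ∈ U_{i+1}, w ∈ U_{i+2}, i+1 < h) there
  -- is an injective ψ : im⁻¹(v) → im⁻¹(w) with x ψ(x) an edge.
  -- (If v ∈ U_0 then im⁻¹(v) = ∅ and the condition is vacuous.)
  Downward : ℕ → Set
  Downward h = ∀ i → suc i < h → ∀ v w → E (suc i) v w →
    Σ ((x : Fin (size i)) → E i x v → Fin (size (suc i))) λ ψ →
      (∀ x p → E i x (ψ x p) × E (suc i) (ψ x p) w) ×
      (∀ x p x' p' → ψ x p ≡ ψ x' p' → x ≡ x')

  Commutative : ℕ → Set
  Commutative h = Upward h × Downward h

  RegularRatio : ℕ → ℕ → Set
  RegularRatio h C = Σ ℕ λ d → 1 ≤ d ×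
    (∀ i → i < h → ∀ x → indeg i x ≡ d) ×
    (∀ i → i < h → ∀ u → outdeg i u ≡ C Data.Nat.* d)

  NonemptyLayers : ℕ → Set
  NonemptyLayers h = ∀ i → i ≤ h → Fin (size i)

  OneToKMatching : ℕ → ℕ → Set
  OneToKMatching h k = ∀ (v : Fin (size 0)) →
    Σ ((x : Fin (size 1)) → E 0 v x → Fin k → Fin (size 0)) λ y →
      (∀ x p j → E 0 (y x p j) x) ×
      (∀ x p j x' p' j' → y x p j ≡ y x' p' j' → x ≡ x' × j ≡ j')

-- The graph is the Cayley digraph of ℤ/N on every layer, with an edge u → u + s
-- for each s in a generating set S. Commutativity of the group provides the
-- upward and downward injections, and every vertex has in- and out-degree |S|.
-- A one-to-k matching at v amounts to choosing, for every s ∈ S, k partners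
-- t ∈ S such that all differences s − t are distinct. With K = k, N = 2K² + 1
-- and S = {1 + K·i} ∪ {−j} (i, j < K), pairing each element of one half with
-- every element of the other does this: the differences (1 + K·i) − (−j) =
-- 1 + K·i + j enumerate 1, …, K², and N > 2K² keeps them apart from their
-- negatives.
module Submission where

open import Defs
open import Algebra.Bundles using (AbelianGroup)
open import Algebra.Core using (Op₁; Op₂)
open import Algebra.Structures using (IsAbelianGroup)
import Algebra.Properties.AbelianGroup as AbelianGroupProperties
import Algebra.Properties.CommutativeSemigroup as CommutativeSemigroupProperties
open import Data.Bool using (Bool; true; false; _∧_; not)
open import Data.Bool.Properties using (∧-identityʳ)
open import Data.Fin using (Fin; toℕ; splitAt; join; combine)
open import Data.Fin.Properties
  using (_≟_; any?; suc-injective; toℕ-injective; toℕ<n; toℕ-fromℕ<; toℕ-combine;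
         combine-injective; splitAt-join; join-splitAt)
open import Data.Nat using (ℕ; zero; suc; _+_; _*_; _∸_; _<_; _%_; s≤s; z≤n)
open import Data.Nat.DivMod using (_mod_; %-distribˡ-+; m<n⇒m%n≡m; n%n≡0; m%n<n)
open import Data.Nat.Properties
  using (+-comm; +-assoc; +-identityʳ; *-identityˡ; m∸n+n≡m; <⇒≤; ≤-trans; m≤m+n; +-mono-≤)
open import Data.Product using (Σ; ∃; _×_; _,_; proj₁; proj₂)
open import Data.Sum using (_⊎_; inj₁; inj₂; [_,_]′)
open import Data.Empty using (⊥-elim)
open import Function using (case_of_)
open import Function.Definitions using (Injective)
open import Level using (0ℓ)
open import Relation.Binary.PropositionalEquality
open import Relation.Nullary.Decidable using (yes; no; does; dec-true; dec-false)

count-cong : ∀ {n} {P Q : Fin n → Bool} → (∀ x → P x ≡ Q x) → count P ≡ count Q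
count-cong {zero} P≗Q = refl
count-cong {suc n} {P} {Q} P≗Q with P Fin.zero | Q Fin.zero | P≗Q Fin.zero
... | true  | true  | refl = cong suc (count-cong (λ x → P≗Q (Fin.suc x)))
... | false | false | refl = count-cong (λ x → P≗Q (Fin.suc x))

count-none : ∀ {n} (P : Fin n → Bool) → (∀ x → P x ≢ true) → count P ≡ 0
count-none {zero} P _ = refl
count-none {suc n} P ¬P with P Fin.zero in P0
... | true  = ⊥-elim (¬P Fin.zero P0)
... | false = count-none (λ x → P (Fin.suc x)) (λ x → ¬P (Fin.suc x))

count-remove : ∀ {n} (P : Fin n → Bool) a → P a ≡ true →
               count P ≡ suc (count (λ x → P x ∧ not (does (x ≟ a))))
count-remove P Fin.zero P0 with P Fin.zero
... | true = cong suc (count-cong (λ x → sym (∧-identityʳ (P (Fin.suc x)))))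
count-remove P (Fin.suc a) Pa with P Fin.zero
... | true  = cong suc (count-remove (λ x → P (Fin.suc x)) a Pa)
... | false = count-remove (λ x → P (Fin.suc x)) a Pa

count-image : ∀ {m n} (f : Fin m → Fin n) → Injective _≡_ _≡_ f →
              (P : Fin n → Bool) → (∀ c → P (f c) ≡ true) →
              (∀ x → P x ≡ true → ∃ λ c → x ≡ f c) → count P ≡ m
count-image {zero} f _ P _ P⊆f = count-none P (λ x Px → case P⊆f x Px of λ ())
count-image {suc m} {n} f f-injective P f⊆P P⊆f = begin
  count P       ≡⟨ count-remove P (f Fin.zero) (f⊆P Fin.zero) ⟩
  suc (count Q) ≡⟨ cong suc (count-image (λ c → f (Fin.suc c)) (λ e → suc-injective (f-injective e))
                                          Q f∘suc⊆Q Q⊆f∘suc) ⟩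
  suc m         ∎
  where
  open ≡-Reasoning
  Q : Fin n → Bool
  Q x = P x ∧ not (does (x ≟ f Fin.zero))
  f∘suc⊆Q : ∀ c → Q (f (Fin.suc c)) ≡ true
  f∘suc⊆Q c rewrite f⊆P (Fin.suc c)
                  | dec-false (f (Fin.suc c) ≟ f Fin.zero) (λ e → case f-injective e of λ ()) = refl
  Q⊆f∘suc : ∀ x → Q x ≡ true → ∃ λ c → x ≡ f (Fin.suc c)
  Q⊆f∘suc x Qx with P x in Px | x ≟ f Fin.zero
  ... | true | no x≢f0 with P⊆f x Px
  ...   | Fin.zero  , x≡f0 = ⊥-elim (x≢f0 x≡f0)
  ...   | Fin.suc c , x≡fc = c , x≡fc

module Cyclic (n : ℕ) where

  -- Abstract: unfolding _mod_ on open terms makes type checking blow up.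
  abstract

    ι : ℕ → Fin (suc n)
    ι m = m mod suc n

    infixl 6 _+ₙ_
    _+ₙ_ : Fin (suc n) → Fin (suc n) → Fin (suc n)
    x +ₙ y = ι (toℕ x + toℕ y)

    -ₙ_ : Fin (suc n) → Fin (suc n)
    -ₙ x = ι (suc n ∸ toℕ x)

    toℕ-ι : ∀ m → toℕ (ι m) ≡ m % suc n
    toℕ-ι m = toℕ-fromℕ< (m%n<n m (suc n))

    toℕ-ι-< : ∀ {m} → m < suc n → toℕ (ι m) ≡ m
    toℕ-ι-< {m} m<N = trans (toℕ-ι m) (m<n⇒m%n≡m m<N)

    ι-toℕ : ∀ x → ι (toℕ x) ≡ x
    ι-toℕ x = toℕ-injective (toℕ-ι-< (toℕ<n x))

    ι-suc≢zero : ∀ {m} → suc m < suc n → ι (suc m) ≢ Fin.zero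
    ι-suc≢zero m<N ι≡0 = case trans (sym (toℕ-ι-< m<N)) (cong toℕ ι≡0) of λ ()

    ι-+ : ∀ m k → ι (m + k) ≡ ι m +ₙ ι k
    ι-+ m k = toℕ-injective (begin
      toℕ (ι (m + k))                   ≡⟨ toℕ-ι (m + k) ⟩
      (m + k) % suc n                   ≡⟨ %-distribˡ-+ m k (suc n) ⟩
      (m % suc n + k % suc n) % suc n   ≡⟨ cong₂ (λ a b → (a + b) % suc n) (toℕ-ι m) (toℕ-ι k) ⟨
      (toℕ (ι m) + toℕ (ι k)) % suc n   ≡⟨ toℕ-ι (toℕ (ι m) + toℕ (ι k)) ⟨
      toℕ (ι m +ₙ ι k)                  ∎)
      where open ≡-Reasoning

    +ₙ-assoc : ∀ x y z → (x +ₙ y) +ₙ z ≡ x +ₙ (y +ₙ z)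
    +ₙ-assoc x y z = begin
      (x +ₙ y) +ₙ z                    ≡⟨ cong (x +ₙ y +ₙ_) (ι-toℕ z) ⟨
      ι (toℕ x + toℕ y) +ₙ ι (toℕ z)   ≡⟨ ι-+ (toℕ x + toℕ y) (toℕ z) ⟨
      ι (toℕ x + toℕ y + toℕ z)        ≡⟨ cong ι (+-assoc (toℕ x) (toℕ y) (toℕ z)) ⟩
      ι (toℕ x + (toℕ y + toℕ z))      ≡⟨ ι-+ (toℕ x) (toℕ y + toℕ z) ⟩
      ι (toℕ x) +ₙ ι (toℕ y + toℕ z)   ≡⟨ cong (_+ₙ (y +ₙ z)) (ι-toℕ x) ⟩
      x +ₙ (y +ₙ z)                    ∎
      where open ≡-Reasoning

    +ₙ-comm : ∀ x y → x +ₙ y ≡ y +ₙ x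
    +ₙ-comm x y = cong ι (+-comm (toℕ x) (toℕ y))

    +ₙ-identityˡ : ∀ x → Fin.zero +ₙ x ≡ x
    +ₙ-identityˡ = ι-toℕ

    +ₙ-identityʳ : ∀ x → x +ₙ Fin.zero ≡ x
    +ₙ-identityʳ x = trans (cong ι (+-identityʳ (toℕ x))) (ι-toℕ x)

    +ₙ-inverseˡ : ∀ x → (-ₙ x) +ₙ x ≡ Fin.zero
    +ₙ-inverseˡ x = begin
      (-ₙ x) +ₙ x                      ≡⟨ cong (-ₙ x +ₙ_) (ι-toℕ x) ⟨
      ι (suc n ∸ toℕ x) +ₙ ι (toℕ x)   ≡⟨ ι-+ (suc n ∸ toℕ x) (toℕ x) ⟨
      ι (suc n ∸ toℕ x + toℕ x)        ≡⟨ cong ι (m∸n+n≡m (<⇒≤ (toℕ<n x))) ⟩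
      ι (suc n)                        ≡⟨ toℕ-injective (trans (toℕ-ι (suc n)) (n%n≡0 (suc n))) ⟩
      Fin.zero                         ∎
      where open ≡-Reasoning

  +ₙ-isAbelianGroup : IsAbelianGroup _≡_ _+ₙ_ Fin.zero -ₙ_
  +ₙ-isAbelianGroup = record
    { isGroup = record
      { isMonoid = record
        { isSemigroup = record
          { isMagma = record { isEquivalence = isEquivalence ; ∙-cong = cong₂ _+ₙ_ }
          ; assoc   = +ₙ-assoc
          }
        ; identity = +ₙ-identityˡ , +ₙ-identityʳ
        }
      ; inverse = +ₙ-inverseˡ , λ x → trans (+ₙ-comm x (-ₙ x)) (+ₙ-inverseˡ x)
      ; ⁻¹-cong = cong -ₙ_
      }
    ; comm = +ₙ-comm
    }

  ℤ/N : AbelianGroup 0ℓ 0ℓ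
  ℤ/N = record { isAbelianGroup = +ₙ-isAbelianGroup }

module Cayley {N : ℕ} {_∙_ : Op₂ (Fin N)} {ε : Fin N} {_⁻¹ : Op₁ (Fin N)}
              (isAbelianGroup : IsAbelianGroup _≡_ _∙_ ε _⁻¹)
              {m : ℕ} (g : Fin m → Fin N) (g-injective : Injective _≡_ _≡_ g) where

  private
    𝔾 : AbelianGroup 0ℓ 0ℓ
    𝔾 = record { isAbelianGroup = isAbelianGroup }

  open AbelianGroup 𝔾 using (_-_; assoc; commutativeSemigroup)
  open AbelianGroupProperties 𝔾 using (∙-cancelˡ; ∙-cancelʳ; ⁻¹-injective; //-rightDividesˡ; //-rightDividesʳ)
  open CommutativeSemigroupProperties commutativeSemigroup using (xy∙z≈xz∙y)

  adjacent : Fin N → Fin N → Bool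
  adjacent u x = does (any? λ c → x ≟ u ∙ g c)

  cayley : LayeredGraph
  cayley = record { size = λ _ → N ; edge = λ _ → adjacent }

  adjacent⁺ : ∀ {u x} c → x ≡ u ∙ g c → adjacent u x ≡ true
  adjacent⁺ {u} {x} c x≡ugc = dec-true (any? λ c → x ≟ u ∙ g c) (c , x≡ugc)

  adjacent⁻ : ∀ {u x} → adjacent u x ≡ true → ∃ λ c → x ≡ u ∙ g c
  adjacent⁻ {u} {x} ux with any? (λ c → x ≟ u ∙ g c)
  ... | yes found = found

  cayley-upward : ∀ h → Upward cayley h
  cayley-upward h i _ u v uv = φ , φ-edges , φ-injective
    where
    φ : ∀ x → E cayley (suc i) v x → Fin N
    φ x vx = u ∙ g (proj₁ (adjacent⁻ vx))
    φ-edges : ∀ x vx → E cayley i u (φ x vx) × E cayley (suc i) (φ x vx) x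
    φ-edges x vx =
      let s , v≡ugs = adjacent⁻ uv
          t , x≡vgt = adjacent⁻ vx
      in adjacent⁺ t refl , adjacent⁺ s (trans x≡vgt (trans (cong (_∙ g t) v≡ugs) (xy∙z≈xz∙y u (g s) (g t))))
    φ-injective : ∀ x vx x′ vx′ → φ x vx ≡ φ x′ vx′ → x ≡ x′
    φ-injective x vx x′ vx′ eq =
      let t , x≡vgt = adjacent⁻ vx
          t′ , x′≡vgt′ = adjacent⁻ vx′
      in trans x≡vgt (trans (cong (v ∙_) (∙-cancelˡ u _ _ eq)) (sym x′≡vgt′))

  cayley-downward : ∀ h → Downward cayley h
  cayley-downward h i _ v w vw with adjacent⁻ vw
  ... | s , w≡vgs = ψ , ψ-edges , λ x _ x′ _ → ∙-cancelʳ (g s) x x′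
    where
    ψ : ∀ x → E cayley i x v → Fin N
    ψ x _ = x ∙ g s
    ψ-edges : ∀ x xv → E cayley i x (ψ x xv) × E cayley (suc i) (ψ x xv) w
    ψ-edges x xv =
      let t , v≡xgt = adjacent⁻ xv in
      adjacent⁺ s refl , adjacent⁺ t (trans w≡vgs (trans (cong (_∙ g s) v≡xgt) (xy∙z≈xz∙y x (g t) (g s))))

  cayley-regular : ∀ h → 0 < m → RegularRatio cayley h 1
  cayley-regular h 0<m = m , 0<m , indeg≡m , outdeg≡m
    where
    indeg≡m : ∀ i → i < h → ∀ x → indeg cayley i x ≡ m
    indeg≡m i _ x = count-image (λ c → x - g c) (λ e → g-injective (⁻¹-injective (∙-cancelˡ x _ _ e)))
      (λ u → adjacent u x)
      (λ c → adjacent⁺ c (sym (//-rightDividesˡ (g c) x)))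
      (λ u ux → let c , x≡ugc = adjacent⁻ ux in
                c , trans (sym (//-rightDividesʳ (g c) u)) (cong (_- g c) (sym x≡ugc)))
    outdeg≡m : ∀ i → i < h → ∀ u → outdeg cayley i u ≡ 1 * m
    outdeg≡m i _ u = trans
      (count-image (λ c → u ∙ g c) (λ e → g-injective (∙-cancelˡ u _ _ e))
        (adjacent u) (λ c → adjacent⁺ c refl) (λ x → adjacent⁻))
      (sym (*-identityˡ m))

  cayley-nonempty : ∀ h → NonemptyLayers cayley h
  cayley-nonempty h _ _ = ε

  cayley-matching : ∀ h {k} (τ : Fin m → Fin k → Fin m) →
                    (∀ {c j c′ j′} → g c - g (τ c j) ≡ g c′ - g (τ c′ j′) → c ≡ c′ × j ≡ j′) →
                    OneToKMatching cayley h k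
  cayley-matching h {k} τ differences-injective v = y , y-edges , y-injective
    where
    y : ∀ x → E cayley 0 v x → Fin k → Fin N
    y x vx j = x - g (τ (proj₁ (adjacent⁻ vx)) j)
    y-edges : ∀ x vx j → E cayley 0 (y x vx j) x
    y-edges x vx j = adjacent⁺ (τ (proj₁ (adjacent⁻ vx)) j) (sym (//-rightDividesˡ _ x))
    y-injective : ∀ x vx j x′ vx′ j′ → y x vx j ≡ y x′ vx′ j′ → x ≡ x′ × j ≡ j′
    y-injective x vx j x′ vx′ j′ eq =
      let c≡c′ , j≡j′ = differences-injective (∙-cancelˡ v _ _ v∙dc≡v∙dc′)
      in trans x≡vgc (trans (cong (λ c → v ∙ g c) c≡c′) (sym x′≡vgc′)) , j≡j′
      where
      c c′ : Fin m
      c = proj₁ (adjacent⁻ vx)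
      c′ = proj₁ (adjacent⁻ vx′)
      x≡vgc : x ≡ v ∙ g c
      x≡vgc = proj₂ (adjacent⁻ vx)
      x′≡vgc′ : x′ ≡ v ∙ g c′
      x′≡vgc′ = proj₂ (adjacent⁻ vx′)
      v∙dc≡v∙dc′ : v ∙ (g c - g (τ c j)) ≡ v ∙ (g c′ - g (τ c′ j′))
      v∙dc≡v∙dc′ = begin
        v ∙ (g c - g (τ c j))     ≡⟨ assoc v (g c) _ ⟨
        (v ∙ g c) - g (τ c j)     ≡⟨ cong (_- g (τ c j)) x≡vgc ⟨
        y x vx j                  ≡⟨ eq ⟩
        y x′ vx′ j′               ≡⟨ cong (_- g (τ c′ j′)) x′≡vgc′ ⟩
        (v ∙ g c′) - g (τ c′ j′)  ≡⟨ assoc v (g c′) _ ⟩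
        v ∙ (g c′ - g (τ c′ j′))  ∎
        where open ≡-Reasoning

module DifferenceSet (k : ℕ) where

  K N : ℕ
  K = suc k
  N = suc (K * K + K * K)

  open Cyclic (K * K + K * K) public
  open AbelianGroup ℤ/N using (_-_)
  open AbelianGroupProperties ℤ/N using (⁻¹-involutive; ⁻¹-injective; ⁻¹-anti-homo‿-; x≈y⇒x∙y⁻¹≈ε)

  spread : Fin (K * K) → Fin N
  spread p = ι (suc (toℕ p))

  spread-injective : Injective _≡_ _≡_ spread
  spread-injective {p} {q} eq =
    toℕ-injective (Data.Nat.Properties.suc-injective (trans (sym (toℕ-ι-< (bound p))) (trans (cong toℕ eq) (toℕ-ι-< (bound q)))))
    where
    bound : ∀ p → suc (toℕ p) < N
    bound p = s≤s (≤-trans (toℕ<n p) (m≤m+n (K * K) (K * K)))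

  spread-+-≢-zero : ∀ p q → spread p +ₙ spread q ≢ Fin.zero
  spread-+-≢-zero p q eq =
    ι-suc≢zero (s≤s (+-mono-≤ (toℕ<n p) (toℕ<n q))) (trans (ι-+ (suc (toℕ p)) (suc (toℕ q))) eq)

  long short : Fin K → Fin N
  long i = ι (suc (K * toℕ i))
  short j = -ₙ ι (toℕ j)

  long-short : ∀ i j → long i - short j ≡ spread (combine i j)
  long-short i j = begin
    long i +ₙ -ₙ (-ₙ ι (toℕ j))       ≡⟨ cong (long i +ₙ_) (⁻¹-involutive (ι (toℕ j))) ⟩
    long i +ₙ ι (toℕ j)              ≡⟨ ι-+ (suc (K * toℕ i)) (toℕ j) ⟨
    ι (suc (K * toℕ i + toℕ j))      ≡⟨ cong (λ m → ι (suc m)) (toℕ-combine i j) ⟨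
    spread (combine i j)             ∎
    where open ≡-Reasoning

  short-long : ∀ j i → short j - long i ≡ -ₙ spread (combine i j)
  short-long j i = trans (sym (⁻¹-anti-homo‿- (long i) (short j))) (cong -ₙ_ (long-short i j))

  long-short≢short-long : ∀ i j i′ j′ → long i - short j ≢ short j′ - long i′
  long-short≢short-long i j i′ j′ eq = spread-+-≢-zero (combine i j) (combine i′ j′) (begin
    spread (combine i j) +ₙ spread (combine i′ j′)      ≡⟨ cong (_+ₙ _) (trans (sym (long-short i j)) (trans eq (short-long j′ i′))) ⟩
    -ₙ spread (combine i′ j′) +ₙ spread (combine i′ j′) ≡⟨ +ₙ-inverseˡ (spread (combine i′ j′)) ⟩
    Fin.zero                                            ∎)
    where open ≡-Reasoning

  generator : Fin K ⊎ Fin K → Fin N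
  generator = [ long , short ]′

  partner : Fin K ⊎ Fin K → Fin K → Fin K ⊎ Fin K
  partner (inj₁ _) j = inj₂ j
  partner (inj₂ _) i = inj₁ i

  generator-differences-injective : ∀ {s t s′ t′} →
    generator s - generator (partner s t) ≡ generator s′ - generator (partner s′ t′) → s ≡ s′ × t ≡ t′
  generator-differences-injective {inj₁ i} {j} {inj₁ i′} {j′} eq =
    let i≡i′ , j≡j′ = combine-injective i j i′ j′
                        (spread-injective (trans (sym (long-short i j)) (trans eq (long-short i′ j′))))
    in cong inj₁ i≡i′ , j≡j′
  generator-differences-injective {inj₂ j} {i} {inj₂ j′} {i′} eq =
    let i≡i′ , j≡j′ = combine-injective i j i′ j′
                        (spread-injective (⁻¹-injective (trans (sym (short-long j i)) (trans eq (short-long j′ i′)))))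
    in cong inj₂ j≡j′ , i≡i′
  generator-differences-injective {inj₁ i} {j} {inj₂ j′} {i′} eq = ⊥-elim (long-short≢short-long i j i′ j′ eq)
  generator-differences-injective {inj₂ j} {i} {inj₁ i′} {j′} eq = ⊥-elim (long-short≢short-long i′ j′ i j (sym eq))

  generator-injective : Injective _≡_ _≡_ generator
  generator-injective {inj₁ i} {inj₁ i′} eq =
    proj₁ (generator-differences-injective {t = Fin.zero} {t′ = Fin.zero} (cong (_- short Fin.zero) eq))
  generator-injective {inj₂ j} {inj₂ j′} eq =
    proj₁ (generator-differences-injective {t = Fin.zero} {t′ = Fin.zero} (cong (_- long Fin.zero) eq))
  -- Equal generators s ≡ s′ would make both s - s′ and s′ - s vanish.
  generator-injective {inj₁ i} {inj₂ j} eq =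
    ⊥-elim (long-short≢short-long i j i j (trans (x≈y⇒x∙y⁻¹≈ε eq) (sym (x≈y⇒x∙y⁻¹≈ε (sym eq)))))
  generator-injective {inj₂ j} {inj₁ i} eq =
    ⊥-elim (long-short≢short-long i j i j (trans (x≈y⇒x∙y⁻¹≈ε (sym eq)) (sym (x≈y⇒x∙y⁻¹≈ε eq))))

  indexedGenerator : Fin (K + K) → Fin N
  indexedGenerator c = generator (splitAt K c)

  indexedPartner : Fin (K + K) → Fin K → Fin (K + K)
  indexedPartner c j = join K K (partner (splitAt K c) j)

  private
    splitAt-injective : Injective _≡_ _≡_ (splitAt K {K})
    splitAt-injective {c} {c′} eq = trans (sym (join-splitAt K K c)) (trans (cong (join K K) eq) (join-splitAt K K c′))

  indexedGenerator-injective : Injective _≡_ _≡_ indexedGenerator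
  indexedGenerator-injective eq = splitAt-injective (generator-injective eq)

  indexed-differences-injective : ∀ {c j c′ j′} →
    indexedGenerator c - indexedGenerator (indexedPartner c j) ≡ indexedGenerator c′ - indexedGenerator (indexedPartner c′ j′) →
    c ≡ c′ × j ≡ j′
  indexed-differences-injective {c} {j} {c′} {j′} eq
    rewrite splitAt-join K K (partner (splitAt K c) j) | splitAt-join K K (partner (splitAt K c′) j′) =
    let s≡s′ , j≡j′ = generator-differences-injective eq in splitAt-injective s≡s′ , j≡j′

lemma7 : (k h : ℕ) → 0 < k → 0 < h →
    Σ LayeredGraph λ G →
      NonemptyLayers G h × Commutative G h × RegularRatio G h 1 × OneToKMatching G h k
lemma7 (suc k) h _ _ =
  cayley ,
  cayley-nonempty h ,
  (cayley-upward h , cayley-downward h) ,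
  cayley-regular h (s≤s z≤n) ,
  cayley-matching h indexedPartner indexed-differences-injective
  where
  open DifferenceSet k
  open Cayley +ₙ-isAbelianGroup indexedGenerator indexedGenerator-injective
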